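{- Let $G$ be a connected graph with $n(G)\geq 2$ and let $H$ be a graph. Then $o(G\odot H)=\mathcal{D}$ if $o(H)\in\{\mathcal{D},\mathcal{N}\}$, and $o(G\odot H)=\mathcal{S}$ if $o(H)=\mathcal{S}$.
   Context: All graphs are finite and simple; $n(G)$ denotes the order of $G$. The Maker-Breaker domination (MBD) game on a graph $G$: two players, Dominator and Staller, alternately select a not yet selected vertex of $G$. Dominator wins if the set of vertices he selected contains a dominating set of $G$; Staller wins if she selects at least one vertex from every dominating set of $G$. In the D-game Dominator moves first, in the S-game Staller moves first. The outcome $o(G)$ is $\mathcal{D}$ if Dominator has a winning strategy in both the D-game and the S-game, $\mathcal{S}$ if Staller has a winning strategy in both, and $\mathcal{N}$ if the player who moves first has a winning strategy. The corona $G\odot H$ is obtained from one copy of $G$ and $n(G)$ disjoint copies of $H$ by joining the $i$-th vertex of $G$ to every vertex of the $i$-th copy of $H$. -}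

module Defs where

open import Data.Nat using (ℕ; zero; suc; _+_; _*_)
open import Data.Fin using (Fin; splitAt; remQuot)
open import Data.Fin.Properties using (_≟_)
open import Data.Fin.Subset using (Subset; _∈_)
open import Data.Product using (Σ; ∃; _×_; _,_; proj₁; proj₂)
open import Data.Sum using (_⊎_; inj₁; inj₂)
open import Data.Empty using (⊥)
open import Data.Bool using (if_then_else_)
open import Relation.Nullary using (¬_; does)
open import Relation.Binary.PropositionalEquality using (_≡_; refl) renaming (sym to ≡-sym)

record Graph : Set₁ where
  field
    n      : ℕ
    Adj    : Fin n → Fin n → Set
    sym    : ∀ {u v} → Adj u v → Adj v u
    irrefl : ∀ {u} → ¬ Adj u u
open Graph public

data Reach (G : Graph) : Fin (n G) → Fin (n G) → Set where
  here : ∀ {u} → Reach G u u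
  step : ∀ {u v w} → Adj G u v → Reach G v w → Reach G u w

Connected : Graph → Set
Connected G = ∀ u v → Reach G u v

-- Corona G ⊙ H: vertices Fin (n G + n G * n H); the first n G vertices are G,
-- the remaining ones are pairs (i , h) (via remQuot): vertex h of the i-th copy of H.
module _ (G H : Graph) where
  private
    V = Fin (n G) ⊎ Fin (n G * n H)

  copy : Fin (n G * n H) → Fin (n G)
  copy p = proj₁ (remQuot {n G} (n H) p)

  pos : Fin (n G * n H) → Fin (n H)
  pos p = proj₂ (remQuot {n G} (n H) p)

  cadj : V → V → Set
  cadj (inj₁ i) (inj₁ j) = Adj G i j
  cadj (inj₁ i) (inj₂ p) = i ≡ copy p
  cadj (inj₂ p) (inj₁ j) = copy p ≡ j
  cadj (inj₂ p) (inj₂ q) =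
    (copy p ≡ copy q)
    × Adj H (pos p) (pos q)

  cadj-sym : ∀ x y → cadj x y → cadj y x
  cadj-sym (inj₁ i) (inj₁ j) a = Graph.sym G a
  cadj-sym (inj₁ i) (inj₂ p) e = ≡-sym e
  cadj-sym (inj₂ p) (inj₁ j) e = ≡-sym e
  cadj-sym (inj₂ p) (inj₂ q) (e , a) = ≡-sym e , Graph.sym H a

  cadj-irr : ∀ x → ¬ cadj x x
  cadj-irr (inj₁ i) a = irrefl G a
  cadj-irr (inj₂ p) (_ , a) = irrefl H a

  corona : Graph
  corona = record
    { n = n G + n G * n H
    ; Adj = λ u v → cadj (splitAt (n G) u) (splitAt (n G) v)
    ; sym = λ {u} {v} → cadj-sym (splitAt (n G) u) (splitAt (n G) v)
    ; irrefl = λ {u} → cadj-irr (splitAt (n G) u)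
    }

_⊙_ : Graph → Graph → Graph
G ⊙ H = corona G H

Dominates : (G : Graph) → (Fin (n G) → Set) → Set
Dominates G P = ∀ v → ∃ λ u → P u × (u ≡ v ⊎ Adj G u v)

data Cell : Set where
  free dom sta : Cell

data Player : Set where
  Dominator Staller : Player

other : Player → Player
other Dominator = Staller
other Staller   = Dominator

mark : Player → Cell
mark Dominator = dom
mark Staller   = sta

State : Graph → Set
State G = Fin (n G) → Cell

play : (G : Graph) → State G → Fin (n G) → Cell → State G
play G s v c w = if does (w ≟ v) then c else s w

-- Winning conditions evaluated on the final (fully claimed) position.
Final : (G : Graph) → Player → State G → Set
Final G Dominator s = Dominates G (λ u → s u ≡ dom)
Final G Staller   s = ∀ (D : Subset (n G)) → Dominates G (λ u → u ∈ D)
                      → ∃ λ v → v ∈ D × s v ≡ sta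

-- Wins G p k q s : player p has a winning strategy from state s,
-- with k moves remaining and player q to move.
Wins : (G : Graph) → Player → ℕ → Player → State G → Set
Wins G p zero    q s = Final G p s
Wins G p (suc k) Dominator s with p
... | Dominator = Σ (Fin (n G)) λ v → s v ≡ free × Wins G p k Staller (play G s v dom)
... | Staller   = ∀ v → s v ≡ free → Wins G p k Staller (play G s v dom)
Wins G p (suc k) Staller s with p
... | Staller   = Σ (Fin (n G)) λ v → s v ≡ free × Wins G p k Dominator (play G s v sta)
... | Dominator = ∀ v → s v ≡ free → Wins G p k Dominator (play G s v sta)

WinsGame : (G : Graph) → (p first : Player) → Set
WinsGame G p first = Wins G p (n G) first (λ _ → free)

data Outcome : Set where
  𝒟 𝒩 𝒮 : Outcome

HasOutcome : Graph → Outcome → Set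
HasOutcome G 𝒟 = WinsGame G Dominator Dominator × WinsGame G Dominator Staller
HasOutcome G 𝒮 = WinsGame G Staller Dominator × WinsGame G Staller Staller
HasOutcome G 𝒩 = WinsGame G Dominator Dominator × WinsGame G Staller Staller

{-# OPTIONS --safe #-}
-- Both players play locally in the stars of G ⊙ H (a centre together with its copy of H).
-- If Dominator wins the D-game on H, he answers every move of Staller inside the star she
-- entered: in a star with free centre he claims the centre when she took a copy vertex, and
-- starts his D-game strategy on the copy when she took the centre; in a star whose centre she
-- owns he follows that strategy. A claimed centre dominates its star, and otherwise the copy is
-- dominated from inside, which also dominates the centre as H is nonempty. If Staller wins the
-- D-game on H, she claims the centre of a star Dominator has not touched (possible as n(G) ≥ 2)
-- and plays her D-game strategy on its copy: a dominating set avoiding that centre must dominate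
-- the copy from inside. Surplus moves never hurt a player in a Maker-Breaker game, which covers
-- every move a strategy does not prescribe.
module Submission where

open import Defs hiding (sym)
open import Data.Nat using (ℕ; zero; suc; _+_; _*_; _≤_; _≥_; s≤s; z≤n)
open import Data.Nat.Properties using (+-suc; m+n≡0⇒m≡0; m+n≡0⇒n≡0; suc-injective; ≤-trans)
open import Data.Fin using (Fin; zero; suc; _↑ˡ_; _↑ʳ_; splitAt; combine; fromℕ<; punchIn)
open import Data.Fin.Properties using (_≟_; ↑ʳ-injective; splitAt-↑ˡ; splitAt-↑ʳ; splitAt⁻¹-↑ˡ; splitAt⁻¹-↑ʳ; remQuot-combine; combine-remQuot; combine-injective; punchInᵢ≢i)
open import Data.Fin.Subset using (Subset; _∈_; _∉_)
open import Data.Fin.Subset.Properties using (_∈?_)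
open import Data.Vec using (tabulate; lookup)
open import Data.Vec.Properties using ([]=⇒lookup; lookup⇒[]=; lookup∘tabulate)
open import Data.Product using (Σ; ∃; _×_; _,_; proj₁; proj₂)
open import Data.Sum using (_⊎_; inj₁; inj₂; [_,_]′)
open import Data.Empty using (⊥-elim)
open import Function using (_∘_; id)
open import Relation.Nullary using (yes; no)
open import Relation.Binary.PropositionalEquality

[free] : Cell → ℕ
[free] free = 1
[free] dom  = 0
[free] sta  = 0

#free : ∀ {m} → (Fin m → Cell) → ℕ
#free {zero}  s = 0
#free {suc m} s = [free] (s zero) + #free (s ∘ suc)

[free]≡0 : ∀ {c} → c ≢ free → [free] c ≡ 0
[free]≡0 {free} c≢free = ⊥-elim (c≢free refl)
[free]≡0 {dom}  _      = refl
[free]≡0 {sta}  _      = refl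

#free-resp : ∀ {m} {s t : Fin m → Cell} → s ≗ t → #free s ≡ #free t
#free-resp {zero}  s≗t = refl
#free-resp {suc m} s≗t = cong₂ _+_ (cong [free] (s≗t zero)) (#free-resp (s≗t ∘ suc))

#free-update : ∀ {m} {s t : Fin m → Cell} {v} → s v ≡ free → t v ≢ free →
               (∀ w → w ≢ v → t w ≡ s w) → #free s ≡ suc (#free t)
#free-update {suc m} {s} {t} {zero} sv tv elsewhere
  rewrite sv | [free]≡0 tv = cong suc (sym (#free-resp (λ w → elsewhere (suc w) λ ())))
#free-update {suc m} {s} {t} {suc v} sv tv elsewhere
  rewrite elsewhere zero (λ ())
        | #free-update {s = s ∘ suc} {t ∘ suc} sv tv
            (λ w w≢v → elsewhere (suc w) (w≢v ∘ Data.Fin.Properties.suc-injective))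
  = +-suc ([free] (s zero)) _

#free≡0⇒≢free : ∀ {m} {s : Fin m → Cell} → #free s ≡ 0 → ∀ v → s v ≢ free
#free≡0⇒≢free {suc m} {s} eq zero sv with () ← trans (sym (cong [free] sv)) (m+n≡0⇒m≡0 _ eq)
#free≡0⇒≢free {suc m} {s} eq (suc v) = #free≡0⇒≢free (m+n≡0⇒n≡0 ([free] (s zero)) eq) v

≢free⇒#free≡0 : ∀ {m} {s : Fin m → Cell} → (∀ v → s v ≢ free) → #free s ≡ 0
≢free⇒#free≡0 {zero}  full = refl
≢free⇒#free≡0 {suc m} full rewrite [free]≡0 (full zero) = ≢free⇒#free≡0 (full ∘ suc)

#free≡suc⇒free : ∀ {m} {s : Fin m → Cell} {k} → #free s ≡ suc k → ∃ λ v → s v ≡ free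
#free≡suc⇒free {zero} ()
#free≡suc⇒free {suc m} {s} eq with s zero in s₀
... | free = zero , s₀
... | dom  = let v , sv = #free≡suc⇒free eq in suc v , sv
... | sta  = let v , sv = #free≡suc⇒free eq in suc v , sv

#free-empty : ∀ {m} → #free {m} (λ _ → free) ≡ m
#free-empty {zero}  = refl
#free-empty {suc m} = cong suc #free-empty

mark≢free : ∀ p → mark p ≢ free
mark≢free Dominator ()
mark≢free Staller   ()

data Turn (p : Player) : Player → Set where
  mine   : Turn p p
  theirs : Turn p (other p)

turn : ∀ p q → Turn p q
turn Dominator Dominator = mine
turn Dominator Staller   = theirs
turn Staller   Dominator = theirs
turn Staller   Staller   = mine

module _ (G : Graph) where

  play-same : ∀ (s : State G) v c → play G s v c v ≡ c
  play-same s v c with v ≟ v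
  ... | yes _   = refl
  ... | no  v≢v = ⊥-elim (v≢v refl)

  play-other : ∀ (s : State G) {v} c {w} → w ≢ v → play G s v c w ≡ s w
  play-other s {v} c {w} w≢v with w ≟ v
  ... | yes w≡v = ⊥-elim (w≢v w≡v)
  ... | no  _   = refl

  play-resp : ∀ {s s' : State G} v c → s ≗ s' → play G s v c ≗ play G s' v c
  play-resp v c s≗s' w with w ≟ v
  ... | yes _ = refl
  ... | no  _ = s≗s' w

  play-comm : ∀ (s : State G) {u v} c d → u ≢ v → play G (play G s u c) v d ≗ play G (play G s v d) u c
  play-comm s {u} {v} c d u≢v w with w ≟ u | w ≟ v
  ... | yes refl | yes refl = ⊥-elim (u≢v refl)
  ... | yes refl | no  _    = refl
  ... | no  _    | yes refl = refl
  ... | no  _    | no  _    = refl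

  #free-play : ∀ {s : State G} {v c} → s v ≡ free → c ≢ free → #free s ≡ suc (#free (play G s v c))
  #free-play {s} {v} {c} sv c≢free =
    #free-update sv (c≢free ∘ trans (sym (play-same s v c))) (λ w → play-other s c)

  after-move : ∀ {s : State G} {v k} q → suc k ≡ #free s → s v ≡ free → k ≡ #free (play G s v (mark q))
  after-move q eq sv = suc-injective (trans eq (#free-play sv (mark≢free q)))

  Final-mono : ∀ p {s s' : State G} → (∀ w → s w ≡ mark p → s' w ≡ mark p) → Final G p s → Final G p s'
  Final-mono Dominator keep F v = let u , su , u↦v = F v in u , keep u su , u↦v
  Final-mono Staller   keep F D D-dom = let v , v∈D , sv = F D D-dom in v , v∈D , keep v sv

  own-turn⁺ : ∀ p {k} {s : State G} {v} → s v ≡ free →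
             Wins G p k (other p) (play G s v (mark p)) → Wins G p (suc k) p s
  own-turn⁺ Dominator sv W = _ , sv , W
  own-turn⁺ Staller   sv W = _ , sv , W

  own-turn⁻ : ∀ p {k} {s : State G} → Wins G p (suc k) p s →
             Σ (Fin (n G)) λ v → s v ≡ free × Wins G p k (other p) (play G s v (mark p))
  own-turn⁻ Dominator W = W
  own-turn⁻ Staller   W = W

  opponent-turn⁺ : ∀ p {k} {s : State G} →
                  (∀ {v} → s v ≡ free → Wins G p k p (play G s v (mark (other p)))) →
                  Wins G p (suc k) (other p) s
  opponent-turn⁺ Dominator W v sv = W sv
  opponent-turn⁺ Staller   W v sv = W sv

  opponent-turn⁻ : ∀ p {k} {s : State G} → Wins G p (suc k) (other p) s →
                  ∀ {v} → s v ≡ free → Wins G p k p (play G s v (mark (other p)))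
  opponent-turn⁻ Dominator W sv = W _ sv
  opponent-turn⁻ Staller   W sv = W _ sv

  Wins-resp : ∀ p q k {s s' : State G} → s ≗ s' → Wins G p k q s → Wins G p k q s'
  Wins-resp p q zero s≗s' W = Final-mono p (λ w → trans (sym (s≗s' w))) W
  Wins-resp p q (suc k) s≗s' W with turn p q
  ... | mine =
    let v , sv , W' = own-turn⁻ p W
    in own-turn⁺ p (trans (sym (s≗s' v)) sv) (Wins-resp p (other p) k (play-resp v (mark p) s≗s') W')
  ... | theirs = opponent-turn⁺ p λ {v} s'v →
    Wins-resp p p k (play-resp v (mark (other p)) s≗s') (opponent-turn⁻ p W (trans (s≗s' v) s'v))

  play-free⁻¹ : ∀ {s : State G} {v} c {u} → c ≢ free → play G s v c u ≡ free → u ≢ v × s u ≡ free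
  play-free⁻¹ {s} {v} c {u} c≢free su with u ≟ v
  ... | yes _ = ⊥-elim (c≢free su)
  ... | no u≢v = u≢v , su

  -- p plays the strategy for s as if v were still free; when it asks for v, any free vertex does instead.
  Wins-extra-mark : ∀ p q k {s : State G} {v} → suc k ≡ #free s → s v ≡ free →
                    Wins G p (suc k) q s → Wins G p k q (play G s v (mark p))
  Wins-extra-mark p q k {s} {v} eq sv W with turn p q
  ... | mine with own-turn⁻ p W
  ...   | w , sw , W' with w ≟ v | k
  ...     | yes refl | zero   = W'
  ...     | yes refl | suc k' =
    let u , su = #free≡suc⇒free {s = play G s v (mark p)} (sym (after-move {s} p eq sv))
    in own-turn⁺ p su (Wins-extra-mark p (other p) k' (after-move {s} p eq sv) su W')
  ...     | no w≢v | zero   =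
    ⊥-elim (#free≡0⇒≢free (sym (after-move {s} p eq sv)) w (trans (play-other s (mark p) w≢v) sw))
  ...     | no w≢v | suc k' =
    own-turn⁺ p (trans (play-other s (mark p) w≢v) sw)
      (Wins-resp p (other p) k' (play-comm s (mark p) (mark p) w≢v)
        (Wins-extra-mark p (other p) k' (after-move {s} p eq sw)
          (trans (play-other s (mark p) (w≢v ∘ sym)) sv) W'))
  Wins-extra-mark p q zero {s} {v} eq sv W | theirs =
    Final-mono p marks-kept (opponent-turn⁻ p W sv)
    where
    marks-kept : ∀ w → play G s v (mark (other p)) w ≡ mark p → play G s v (mark p) w ≡ mark p
    marks-kept w with w ≟ v
    ... | yes _ = λ _ → refl
    ... | no  _ = λ sw → sw
  Wins-extra-mark p q (suc k) {s} {v} eq sv W | theirs = opponent-turn⁺ p λ {u} su' →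
    let u≢v , su = play-free⁻¹ {s} (mark p) (mark≢free p) su'
    in Wins-resp p p k (play-comm s (mark (other p)) (mark p) u≢v)
         (Wins-extra-mark p p k (after-move {s} (other p) eq su)
           (trans (play-other s (mark (other p)) (u≢v ∘ sym)) sv) (opponent-turn⁻ p W su))

  -- In a play from the empty board the number of moves left is the number of free vertices.
  WinsFrom : Player → Player → State G → Set
  WinsFrom p q s = Wins G p (#free s) q s

  WinsFrom-resp : ∀ p q {s s' : State G} → s ≗ s' → WinsFrom p q s → WinsFrom p q s'
  WinsFrom-resp p q {s} {s'} s≗s' W =
    subst (λ k → Wins G p k q s') (#free-resp s≗s') (Wins-resp p q (#free s) s≗s' W)

  WinsFrom-final : ∀ p q {s : State G} → #free s ≡ 0 → WinsFrom p q s → Final G p s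
  WinsFrom-final p q {s} eq W = subst (λ k → Wins G p k q s) eq W

  WinsFrom-extra-mark : ∀ p q {s : State G} {v} → s v ≡ free → WinsFrom p q s → WinsFrom p q (play G s v (mark p))
  WinsFrom-extra-mark p q {s} sv W =
    Wins-extra-mark p q _ (sym eq) sv (subst (λ k → Wins G p k q s) eq W)
    where eq = #free-play sv (mark≢free p)

  WinsFrom-opponent-move : ∀ p {s : State G} {v} → s v ≡ free →
                           WinsFrom p (other p) s → WinsFrom p p (play G s v (mark (other p)))
  WinsFrom-opponent-move p {s} sv W =
    opponent-turn⁻ p (subst (λ k → Wins G p k (other p) s) eq W) sv
    where eq = #free-play sv (mark≢free (other p))

  WinsFrom-own-turn : ∀ p {s : State G} → WinsFrom p p s →
                      WinsFrom p (other p) s ⊎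
                      Σ (Fin (n G)) λ v → s v ≡ free × WinsFrom p (other p) (play G s v (mark p))
  WinsFrom-own-turn p {s} W with #free s in eq
  ... | zero  = inj₁ W
  ... | suc k =
    let v , sv , W' = own-turn⁻ p W
    in inj₂ (v , sv , subst (λ k → Wins G p k (other p) (play G s v (mark p))) (after-move {s} p (sym eq) sv) W')

  WinsGame⇒WinsFrom : ∀ p q → WinsGame G p q → WinsFrom p q (λ _ → free)
  WinsGame⇒WinsFrom p q = subst (λ k → Wins G p k q (λ _ → free)) (sym (#free-empty {n G}))

  WinsFrom⇒WinsGame : ∀ p q → WinsFrom p q (λ _ → free) → WinsGame G p q
  WinsFrom⇒WinsGame p q = subst (λ k → Wins G p k q (λ _ → free)) (#free-empty {n G})

Restorable : (G : Graph) → Player → (State G → Set) → State G → Set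
Restorable G p I s = I s ⊎ Σ (Fin (n G)) λ v → s v ≡ free × I (play G s v (mark p))

module InvariantStrategy (G : Graph) (p : Player) (I : State G → Set)
  (final   : ∀ {s} → #free s ≡ 0 → I s → Final G p s)
  (extend  : ∀ {s v} → I s → s v ≡ free → I (play G s v (mark p)))
  (restore : ∀ {s v} → I s → s v ≡ free → Restorable G p I (play G s v (mark (other p))))
  where
  private
    to-move   : ∀ k {s} → k ≡ #free s → Restorable G p I s → Wins G p k p s
    waiting   : ∀ k {s} → k ≡ #free s → I s → Wins G p k (other p) s
    replying  : ∀ k {s} → suc k ≡ #free s →
                (∀ {v} → s v ≡ free → Restorable G p I (play G s v (mark (other p)))) →
                Wins G p (suc k) (other p) s

    to-move zero    eq (inj₁ J)            = final (sym eq) J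
    to-move zero    eq (inj₂ (v , sv , _)) = ⊥-elim (#free≡0⇒≢free (sym eq) v sv)
    to-move (suc k) {s} eq (inj₁ J) =
      let v , sv = #free≡suc⇒free {s = s} (sym eq)
      in own-turn⁺ G p sv (waiting k (after-move G {s} p eq sv) (extend J sv))
    to-move (suc k) {s} eq (inj₂ (v , sv , J)) = own-turn⁺ G p sv (waiting k (after-move G {s} p eq sv) J)

    waiting zero    eq J = final (sym eq) J
    waiting (suc k) eq J = replying k eq (restore J)

    replying k {s} eq R = opponent-turn⁺ G p λ sv → to-move k (after-move G {s} (other p) eq sv) (R sv)

  restorable⇒WinsFrom : ∀ {s} → Restorable G p I s → WinsFrom G p p s
  restorable⇒WinsFrom = to-move _ refl

  invariant⇒WinsFrom : ∀ {s} → I s → WinsFrom G p (other p) s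
  invariant⇒WinsFrom = waiting _ refl

  replies⇒WinsFrom : ∀ {s v} → s v ≡ free →
                     (∀ {v} → s v ≡ free → Restorable G p I (play G s v (mark (other p)))) →
                     WinsFrom G p (other p) s
  replies⇒WinsFrom {s} {v} sv R with #free s in eq
  ... | zero  = ⊥-elim (#free≡0⇒≢free eq v sv)
  ... | suc k = replying k (sym eq) R

module Corona (G H : Graph) where

  centre : Fin (n G) → Fin (n (G ⊙ H))
  centre i = i ↑ˡ (n G * n H)

  inCopy : Fin (n G) → Fin (n H) → Fin (n (G ⊙ H))
  inCopy i h = n G ↑ʳ combine i h

  star : Fin (n (G ⊙ H)) → Fin (n G)
  star x = [ id , copy G H ]′ (splitAt (n G) x)

  splitAt-centre : ∀ i → splitAt (n G) (centre i) ≡ inj₁ i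
  splitAt-centre i = splitAt-↑ˡ (n G) i (n G * n H)

  splitAt-inCopy : ∀ i h → splitAt (n G) (inCopy i h) ≡ inj₂ (combine i h)
  splitAt-inCopy i h = splitAt-↑ʳ (n G) (n G * n H) (combine i h)

  copy-combine : ∀ i h → copy G H (combine i h) ≡ i
  copy-combine i h = cong proj₁ (remQuot-combine {n G} {n H} i h)

  pos-combine : ∀ i h → pos G H (combine i h) ≡ h
  pos-combine i h = cong proj₂ (remQuot-combine {n G} {n H} i h)

  star-centre : ∀ i → star (centre i) ≡ i
  star-centre i = cong [ id , copy G H ]′ (splitAt-centre i)

  star-inCopy : ∀ i h → star (inCopy i h) ≡ i
  star-inCopy i h = trans (cong [ id , copy G H ]′ (splitAt-inCopy i h)) (copy-combine i h)

  centre≢inCopy : ∀ i j h → centre i ≢ inCopy j h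
  centre≢inCopy i j h eq with () ← trans (sym (splitAt-centre i)) (trans (cong (splitAt (n G)) eq) (splitAt-inCopy j h))

  inCopy-injective : ∀ {i j h h'} → inCopy i h ≡ inCopy j h' → i ≡ j × h ≡ h'
  inCopy-injective {i} {j} {h} {h'} eq = combine-injective i h j h' (↑ʳ-injective (n G) _ _ eq)

  data View : Fin (n (G ⊙ H)) → Set where
    centreᵛ : ∀ i → View (centre i)
    inCopyᵛ : ∀ i h → View (inCopy i h)

  view : ∀ x → View x
  view x with splitAt (n G) x in eq
  ... | inj₁ i = subst View (splitAt⁻¹-↑ˡ eq) (centreᵛ i)
  ... | inj₂ p = subst View (trans (cong (n G ↑ʳ_) (combine-remQuot {n G} (n H) p)) (splitAt⁻¹-↑ʳ eq))
                   (inCopyᵛ (copy G H p) (pos G H p))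

  centre-adj-inCopy : ∀ i h → Adj (G ⊙ H) (centre i) (inCopy i h)
  centre-adj-inCopy i h = subst₂ (cadj G H) (sym (splitAt-centre i)) (sym (splitAt-inCopy i h)) (sym (copy-combine i h))

  inCopy-adj-inCopy : ∀ i {h h'} → Adj H h h' → Adj (G ⊙ H) (inCopy i h) (inCopy i h')
  inCopy-adj-inCopy i {h} {h'} a = subst₂ (cadj G H) (sym (splitAt-inCopy i h)) (sym (splitAt-inCopy i h'))
    (trans (copy-combine i h) (sym (copy-combine i h')) , subst₂ (Adj H) (sym (pos-combine i h)) (sym (pos-combine i h')) a)

  centre-adj-inCopy⁻¹ : ∀ {j i h} → Adj (G ⊙ H) (centre j) (inCopy i h) → j ≡ i
  centre-adj-inCopy⁻¹ {j} {i} {h} a =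
    trans (subst₂ (cadj G H) (splitAt-centre j) (splitAt-inCopy i h) a) (copy-combine i h)

  inCopy-adj-inCopy⁻¹ : ∀ {j h' i h} → Adj (G ⊙ H) (inCopy j h') (inCopy i h) → j ≡ i × Adj H h' h
  inCopy-adj-inCopy⁻¹ {j} {h'} {i} {h} a =
    let same , b = subst₂ (cadj G H) (splitAt-inCopy j h') (splitAt-inCopy i h) a
    in trans (sym (copy-combine j h')) (trans same (copy-combine i h)) ,
       subst₂ (Adj H) (pos-combine j h') (pos-combine i h) b

  _↾_ : State (G ⊙ H) → Fin (n G) → State H
  (s ↾ i) h = s (inCopy i h)

  play-centre-elsewhere : ∀ s {x} c {j} → star x ≢ j → play (G ⊙ H) s x c (centre j) ≡ s (centre j)
  play-centre-elsewhere s c {j} x∉j =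
    play-other (G ⊙ H) s c λ eq → x∉j (trans (cong star (sym eq)) (star-centre j))

  play-↾-elsewhere : ∀ s {x} c {j} → star x ≢ j → (play (G ⊙ H) s x c ↾ j) ≗ s ↾ j
  play-↾-elsewhere s c {j} x∉j h =
    play-other (G ⊙ H) s c λ eq → x∉j (trans (cong star (sym eq)) (star-inCopy j h))

  play-inCopy-centre : ∀ s {i h} c j → play (G ⊙ H) s (inCopy i h) c (centre j) ≡ s (centre j)
  play-inCopy-centre s {i} {h} c j = play-other (G ⊙ H) s c (centre≢inCopy j i h)

  play-centre-↾ : ∀ s {i} c j → (play (G ⊙ H) s (centre i) c ↾ j) ≗ s ↾ j
  play-centre-↾ s {i} c j h = play-other (G ⊙ H) s c (centre≢inCopy i j h ∘ sym)

  play-inCopy-↾ : ∀ s {i h} c → (play (G ⊙ H) s (inCopy i h) c ↾ i) ≗ play H (s ↾ i) h c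
  play-inCopy-↾ s {i} {h} c h' with h' ≟ h
  ... | yes refl = play-same (G ⊙ H) s (inCopy i h) c
  ... | no h'≢h  = play-other (G ⊙ H) s c (h'≢h ∘ proj₂ ∘ inCopy-injective)

  star-≢ : ∀ {x i j} → star x ≡ i → j ≢ i → star x ≢ j
  star-≢ x∈i j≢i x∈j = j≢i (trans (sym x∈j) x∈i)

  #free-↾ : ∀ {s} i → #free s ≡ 0 → #free (s ↾ i) ≡ 0
  #free-↾ {s} i eq = ≢free⇒#free≡0 λ h → #free≡0⇒≢free eq (inCopy i h)

  copySubset : Subset (n (G ⊙ H)) → Fin (n G) → Subset (n H)
  copySubset D i = tabulate λ h → lookup D (inCopy i h)

  ∈-copySubset⁺ : ∀ {D i h} → inCopy i h ∈ D → h ∈ copySubset D i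
  ∈-copySubset⁺ {D} {i} {h} m = lookup⇒[]= h _ (trans (lookup∘tabulate _ h) ([]=⇒lookup m))

  ∈-copySubset⁻ : ∀ {D i h} → h ∈ copySubset D i → inCopy i h ∈ D
  ∈-copySubset⁻ {D} {i} {h} m = lookup⇒[]= (inCopy i h) D (trans (sym (lookup∘tabulate _ h)) ([]=⇒lookup m))

  dominates-copy : ∀ {D i} → Dominates (G ⊙ H) (_∈ D) → centre i ∉ D → Dominates H (_∈ copySubset D i)
  dominates-copy {D} {i} D-dom centre∉D h with D-dom (inCopy i h)
  ... | u , u∈D , u↦h with view u | u↦h
  ...   | centreᵛ j   | inj₁ eq  = ⊥-elim (centre≢inCopy j i h eq)
  ...   | centreᵛ j   | inj₂ adj =
    ⊥-elim (centre∉D (subst (λ j → centre j ∈ D) (centre-adj-inCopy⁻¹ adj) u∈D))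
  ...   | inCopyᵛ j h' | inj₁ eq  = h , ∈-copySubset⁺ (subst (_∈ D) eq u∈D) , inj₁ refl
  ...   | inCopyᵛ j h' | inj₂ adj =
    let j≡i , a = inCopy-adj-inCopy⁻¹ adj
    in h' , ∈-copySubset⁺ (subst (λ j → inCopy j h' ∈ D) j≡i u∈D) , inj₂ a

module DominatorStrategy (G H : Graph) (h₀ : Fin (n H)) where
  open Corona G H

  data SafeAt (s : State (G ⊙ H)) (i : Fin (n G)) : Set where
    open-star : s (centre i) ≡ free → WinsFrom H Dominator Dominator (s ↾ i) → SafeAt s i
    claimed   : s (centre i) ≡ dom → SafeAt s i
    defended  : s (centre i) ≡ sta → WinsFrom H Dominator Staller (s ↾ i) → SafeAt s i

  Safe : State (G ⊙ H) → Set
  Safe s = ∀ i → SafeAt s i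

  SafeAt-elsewhere : ∀ {s x} c {j} → star x ≢ j → SafeAt s j → SafeAt (play (G ⊙ H) s x c) j
  SafeAt-elsewhere {s} c x∉j (open-star cf W) =
    open-star (trans (play-centre-elsewhere s c x∉j) cf)
      (WinsFrom-resp H Dominator Dominator (sym ∘ play-↾-elsewhere s c x∉j) W)
  SafeAt-elsewhere {s} c x∉j (claimed cd) = claimed (trans (play-centre-elsewhere s c x∉j) cd)
  SafeAt-elsewhere {s} c x∉j (defended cs W) =
    defended (trans (play-centre-elsewhere s c x∉j) cs)
      (WinsFrom-resp H Dominator Staller (sym ∘ play-↾-elsewhere s c x∉j) W)

  SafeAt-extra-mark : ∀ {s i h} → s (inCopy i h) ≡ free → SafeAt s i → SafeAt (play (G ⊙ H) s (inCopy i h) dom) i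
  SafeAt-extra-mark {s} {i} sh (open-star cf W) =
    open-star (trans (play-inCopy-centre s dom i) cf)
      (WinsFrom-resp H Dominator Dominator (sym ∘ play-inCopy-↾ s dom) (WinsFrom-extra-mark H Dominator Dominator sh W))
  SafeAt-extra-mark {s} {i} sh (claimed cd) = claimed (trans (play-inCopy-centre s dom i) cd)
  SafeAt-extra-mark {s} {i} sh (defended cs W) =
    defended (trans (play-inCopy-centre s dom i) cs)
      (WinsFrom-resp H Dominator Staller (sym ∘ play-inCopy-↾ s dom) (WinsFrom-extra-mark H Dominator Staller sh W))

  SafeAt-final : ∀ {s i} → #free s ≡ 0 → SafeAt s i → s (centre i) ≡ dom ⊎ Final H Dominator (s ↾ i)
  SafeAt-final {i = i} s₀ (open-star cf _) = ⊥-elim (#free≡0⇒≢free s₀ (centre i) cf)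
  SafeAt-final         s₀ (claimed cd)     = inj₁ cd
  SafeAt-final {i = i} s₀ (defended _ W)   = inj₂ (WinsFrom-final H Dominator Staller (#free-↾ i s₀) W)

  Safe-assemble : ∀ {s i} → (∀ j → j ≢ i → SafeAt s j) → SafeAt s i → Safe s
  Safe-assemble {i = i} others at j with j ≟ i
  ... | yes refl = at
  ... | no  j≢i  = others j j≢i

  safe-final : ∀ {s} → #free s ≡ 0 → Safe s → Final (G ⊙ H) Dominator s
  safe-final {s} s₀ S v with view v
  ... | centreᵛ i with SafeAt-final s₀ (S i)
  ...   | inj₁ cd = centre i , cd , inj₁ refl
  ...   | inj₂ F  = let u , su , _ = F h₀ in inCopy i u , su , inj₂ (Graph.sym (G ⊙ H) (centre-adj-inCopy i u))
  safe-final {s} s₀ S v | inCopyᵛ i h with SafeAt-final s₀ (S i)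
  ...   | inj₁ cd = centre i , cd , inj₂ (centre-adj-inCopy i h)
  ...   | inj₂ F with F h
  ...     | u , su , inj₁ u≡h = inCopy i u , su , inj₁ (cong (inCopy i) u≡h)
  ...     | u , su , inj₂ adj = inCopy i u , su , inj₂ (inCopy-adj-inCopy i adj)

  safe-extend : ∀ {s y} → Safe s → s y ≡ free → Safe (play (G ⊙ H) s y dom)
  safe-extend {s} {y} S sy j with view y
  ... | centreᵛ i with i ≟ j
  ...   | yes refl = claimed (play-same (G ⊙ H) s (centre i) dom)
  ...   | no  i≢j  = SafeAt-elsewhere dom (star-≢ (star-centre i) (i≢j ∘ sym)) (S j)
  safe-extend {s} {y} S sy j | inCopyᵛ i h with i ≟ j
  ...   | yes refl = SafeAt-extra-mark sy (S i)
  ...   | no  i≢j  = SafeAt-elsewhere dom (star-≢ (star-inCopy i h) (i≢j ∘ sym)) (S j)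

  elsewhere-after : ∀ {s x i} c → star x ≡ i → (∀ j → j ≢ i → SafeAt s j) →
                    ∀ j → j ≢ i → SafeAt (play (G ⊙ H) s x c) j
  elsewhere-after c x∈i others j j≢i = SafeAt-elsewhere c (star-≢ x∈i j≢i) (others j j≢i)

  continue-in-star : ∀ {s i} → s (centre i) ≡ sta → WinsFrom H Dominator Dominator (s ↾ i) →
           (∀ j → j ≢ i → SafeAt s j) → Restorable (G ⊙ H) Dominator Safe s
  continue-in-star {s} {i} cs W others with WinsFrom-own-turn H Dominator W
  ... | inj₁ W' = inj₁ (Safe-assemble others (defended cs W'))
  ... | inj₂ (h , sh , W') = inj₂ (inCopy i h , sh ,
          Safe-assemble (elsewhere-after dom (star-inCopy i h) others)
            (defended (trans (play-inCopy-centre s dom i) cs)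
              (WinsFrom-resp H Dominator Staller (sym ∘ play-inCopy-↾ s dom) W')))

  safe-restore : ∀ {s x} → Safe s → s x ≡ free → Restorable (G ⊙ H) Dominator Safe (play (G ⊙ H) s x sta)
  safe-restore {s} {x} S sx with view x
  ... | centreᵛ i with S i
  ...   | open-star _ W =
          continue-in-star (play-same (G ⊙ H) s (centre i) sta)
            (WinsFrom-resp H Dominator Dominator (sym ∘ play-centre-↾ s sta i) W)
            (elsewhere-after sta (star-centre i) (λ j _ → S j))
  ...   | claimed cd    with () ← trans (sym cd) sx
  ...   | defended cs _ with () ← trans (sym cs) sx
  safe-restore {s} {x} S sx | inCopyᵛ i h with S i
  ...   | open-star cf _ =
          inj₂ (centre i , trans (play-inCopy-centre s sta i) cf ,
            Safe-assemble (elsewhere-after dom (star-centre i) (elsewhere-after sta (star-inCopy i h) (λ j _ → S j)))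
              (claimed (play-same (G ⊙ H) (play (G ⊙ H) s (inCopy i h) sta) (centre i) dom)))
  ...   | claimed cd =
          inj₁ (Safe-assemble (elsewhere-after sta (star-inCopy i h) (λ j _ → S j))
                  (claimed (trans (play-inCopy-centre s sta i) cd)))
  ...   | defended cs W =
          continue-in-star (trans (play-inCopy-centre s sta i) cs)
            (WinsFrom-resp H Dominator Dominator (sym ∘ play-inCopy-↾ s sta) (WinsFrom-opponent-move H Dominator sx W))
            (elsewhere-after sta (star-inCopy i h) (λ j _ → S j))

  safe-empty : WinsGame H Dominator Dominator → Safe (λ _ → free)
  safe-empty W i = open-star refl (WinsGame⇒WinsFrom H Dominator Dominator W)

  dominator-wins : WinsGame H Dominator Dominator → HasOutcome (G ⊙ H) 𝒟
  dominator-wins W =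
    WinsFrom⇒WinsGame (G ⊙ H) Dominator Dominator (restorable⇒WinsFrom (inj₁ (safe-empty W))) ,
    WinsFrom⇒WinsGame (G ⊙ H) Dominator Staller (invariant⇒WinsFrom (safe-empty W))
    where open InvariantStrategy (G ⊙ H) Dominator Safe safe-final safe-extend safe-restore

≢-witness : ∀ {m} → 2 ≤ m → (j : Fin m) → ∃ λ i → j ≢ i
≢-witness (s≤s (s≤s _)) j = punchIn j zero , punchInᵢ≢i j zero ∘ sym

module StallerStrategy (G H : Graph) where
  open Corona G H

  data HoldsStar (s : State (G ⊙ H)) : Set where
    holding : ∀ i → s (centre i) ≡ sta → WinsFrom H Staller Dominator (s ↾ i) → HoldsStar s

  holds-elsewhere : ∀ {s x i} c → star x ≢ i → s (centre i) ≡ sta → WinsFrom H Staller Dominator (s ↾ i) →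
                    HoldsStar (play (G ⊙ H) s x c)
  holds-elsewhere {s} c x∉i cs W =
    holding _ (trans (play-centre-elsewhere s c x∉i) cs)
      (WinsFrom-resp H Staller Dominator (sym ∘ play-↾-elsewhere s c x∉i) W)

  holds-final : ∀ {s} → #free s ≡ 0 → HoldsStar s → Final (G ⊙ H) Staller s
  holds-final {s} s₀ (holding i cs W) D D-dom with centre i ∈? D
  ... | yes centre∈D = centre i , centre∈D , cs
  ... | no  centre∉D =
    let h , h∈D , sh = WinsFrom-final H Staller Dominator (#free-↾ {s} i s₀) W
                         (copySubset D i) (dominates-copy D-dom centre∉D)
    in inCopy i h , ∈-copySubset⁻ h∈D , sh

  holds-extend : ∀ {s y} → HoldsStar s → s y ≡ free → HoldsStar (play (G ⊙ H) s y sta)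
  holds-extend {s} {y} (holding i cs W) sy with view y
  ... | centreᵛ j with j ≟ i
  ...   | yes refl with () ← trans (sym cs) sy
  ...   | no  j≢i  = holds-elsewhere sta (star-≢ (star-centre j) (j≢i ∘ sym)) cs W
  holds-extend {s} {y} (holding i cs W) sy | inCopyᵛ j h with j ≟ i
  ...   | yes refl =
    holding i (trans (play-inCopy-centre s sta i) cs)
      (WinsFrom-resp H Staller Dominator (sym ∘ play-inCopy-↾ s sta) (WinsFrom-extra-mark H Staller Dominator sy W))
  ...   | no  j≢i  = holds-elsewhere sta (star-≢ (star-inCopy j h) (j≢i ∘ sym)) cs W

  continue-in-star : ∀ {s i} → s (centre i) ≡ sta → WinsFrom H Staller Staller (s ↾ i) →
                     Restorable (G ⊙ H) Staller HoldsStar s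
  continue-in-star {s} {i} cs W with WinsFrom-own-turn H Staller W
  ... | inj₁ W' = inj₁ (holding i cs W')
  ... | inj₂ (h , sh , W') =
    inj₂ (inCopy i h , sh , holding i (trans (play-inCopy-centre s sta i) cs)
                              (WinsFrom-resp H Staller Dominator (sym ∘ play-inCopy-↾ s sta) W'))

  holds-restore : ∀ {s x} → HoldsStar s → s x ≡ free →
                  Restorable (G ⊙ H) Staller HoldsStar (play (G ⊙ H) s x dom)
  holds-restore {s} {x} (holding i cs W) sx with view x
  ... | centreᵛ j with j ≟ i
  ...   | yes refl with () ← trans (sym cs) sx
  ...   | no  j≢i  = inj₁ (holds-elsewhere dom (star-≢ (star-centre j) (j≢i ∘ sym)) cs W)
  holds-restore {s} {x} (holding i cs W) sx | inCopyᵛ j h with j ≟ i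
  ...   | yes refl =
    continue-in-star (trans (play-inCopy-centre s dom i) cs)
      (WinsFrom-resp H Staller Staller (sym ∘ play-inCopy-↾ s dom) (WinsFrom-opponent-move H Staller sx W))
  ...   | no  j≢i  = inj₁ (holds-elsewhere dom (star-≢ (star-inCopy j h) (j≢i ∘ sym)) cs W)

  claim-star : ∀ {s i} → WinsGame H Staller Dominator →
               s (centre i) ≡ free → (∀ h → s (inCopy i h) ≡ free) → Restorable (G ⊙ H) Staller HoldsStar s
  claim-star {s} {i} W ci copy-free =
    inj₂ (centre i , ci , holding i (play-same (G ⊙ H) s (centre i) sta)
      (WinsFrom-resp H Staller Dominator (λ h → sym (trans (play-centre-↾ s sta i h) (copy-free h)))
        (WinsGame⇒WinsFrom H Staller Dominator W)))

  staller-wins : 2 ≤ n G → WinsGame H Staller Dominator → HasOutcome (G ⊙ H) 𝒮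
  staller-wins two W =
    WinsFrom⇒WinsGame (G ⊙ H) Staller Dominator (replies⇒WinsFrom {v = centre i₀} refl answer-first-move) ,
    WinsFrom⇒WinsGame (G ⊙ H) Staller Staller (restorable⇒WinsFrom (claim-star {i = i₀} W refl λ _ → refl))
    where
    open InvariantStrategy (G ⊙ H) Staller HoldsStar holds-final holds-extend holds-restore

    empty : State (G ⊙ H)
    empty _ = free

    i₀ : Fin (n G)
    i₀ = fromℕ< (≤-trans (s≤s z≤n) two)

    answer-first-move : ∀ {x} → empty x ≡ free → Restorable (G ⊙ H) Staller HoldsStar (play (G ⊙ H) empty x dom)
    answer-first-move {x} _ =
      let i , x∉i = ≢-witness two (star x)
      in claim-star W (play-centre-elsewhere empty dom x∉i) (play-↾-elsewhere empty dom x∉i)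

theorem2p1 : (G H : Graph) → Connected G → n G ≥ 2 → n H ≥ 1 →
    ((HasOutcome H 𝒟 ⊎ HasOutcome H 𝒩) → HasOutcome (G ⊙ H) 𝒟)
    × (HasOutcome H 𝒮 → HasOutcome (G ⊙ H) 𝒮)
theorem2p1 G H _ two one = dominator-case , staller-case
  where
  open DominatorStrategy G H (fromℕ< one)
  open StallerStrategy G H

  dominator-case : HasOutcome H 𝒟 ⊎ HasOutcome H 𝒩 → HasOutcome (G ⊙ H) 𝒟
  dominator-case (inj₁ (W , _)) = dominator-wins W
  dominator-case (inj₂ (W , _)) = dominator-wins W

  staller-case : HasOutcome H 𝒮 → HasOutcome (G ⊙ H) 𝒮
  staller-case (W , _) = staller-wins two W
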